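{- Suppose $\mathcal{C}$ has an initial object $0$. Let $(T,\tau)$ be the companion of an endofunctor $B\colon\mathcal{C}\to\mathcal{C}$, with corresponding monad $(T,\eta,\mu)$, and regard $(T0,\tau_0\circ T!_{B0})$ as the final $B$-coalgebra. Let $F\colon\mathcal{C}\to\mathcal{C}$ be a functor, $\lambda\colon FB\Rightarrow BF$ a natural transformation, $\alpha\colon FT0\to T0$ the algebra induced by $\lambda$ on this final coalgebra, and $\bar\lambda\colon F\Rightarrow T$ the unique morphism $(F,\lambda)\to(T,\tau)$ in $\mathrm{DL}(B)$. Then $\alpha=\mu_0\circ\bar\lambda_{T0}$.
   Context: $\mathrm{DL}(B)$: objects $(F,\lambda)$ with $\lambda\colon FB\Rightarrow BF$ natural; morphisms $(F,\lambda)\to(G,\rho)$ are natural $\kappa\colon F\Rightarrow G$ with $\rho\circ\kappa B=B\kappa\circ\lambda$; the companion is a final object. The monad structure $(T,\eta,\mu)$ is the unique one with $B\eta=\tau\circ\eta B$ and $\tau\circ\mu B=B\mu\circ\tau T\circ T\tau$. The $B$-coalgebra $(T0,\tau_0\circ T!_{B0})$ is final (where $!_{B0}\colon0\to B0$). For a final coalgebra $(Z,\zeta)$, the algebra induced by $\lambda$ is the unique $\alpha\colon FZ\to Z$ with $\zeta\circ\alpha=B\alpha\circ\lambda_Z\circ F\zeta$. -}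

module Defs where

open import Level using (Level; _⊔_; suc)
open import Relation.Binary using (Rel; IsEquivalence)

record Category (o ℓ e : Level) : Set (suc (o ⊔ ℓ ⊔ e)) where
  infix  4 _≈_
  infixr 9 _∘_
  field
    Obj       : Set o
    Hom       : Obj → Obj → Set ℓ
    _≈_       : ∀ {A B} → Rel (Hom A B) e
    id        : ∀ {A} → Hom A A
    _∘_       : ∀ {A B C} → Hom B C → Hom A B → Hom A C
    assoc     : ∀ {A B C D} {f : Hom A B} {g : Hom B C} {h : Hom C D} →
                (h ∘ g) ∘ f ≈ h ∘ (g ∘ f)
    identityˡ : ∀ {A B} {f : Hom A B} → id ∘ f ≈ f
    identityʳ : ∀ {A B} {f : Hom A B} → f ∘ id ≈ f
    equiv     : ∀ {A B} → IsEquivalence (_≈_ {A} {B})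
    ∘-resp-≈  : ∀ {A B C} {f h : Hom B C} {g i : Hom A B} →
                f ≈ h → g ≈ i → f ∘ g ≈ h ∘ i

module _ {o ℓ e : Level} (C : Category o ℓ e) where
  open Category C

  record IsInitial (⊥ : Obj) : Set (o ⊔ ℓ ⊔ e) where
    field
      !        : ∀ {A} → Hom ⊥ A
      !-unique : ∀ {A} (f : Hom ⊥ A) → ! ≈ f

  record Endofunctor : Set (o ⊔ ℓ ⊔ e) where
    field
      F₀           : Obj → Obj
      F₁           : ∀ {A B} → Hom A B → Hom (F₀ A) (F₀ B)
      identity     : ∀ {A} → F₁ (id {A}) ≈ id
      homomorphism : ∀ {X Y Z} {f : Hom X Y} {g : Hom Y Z} →
                     F₁ (g ∘ f) ≈ F₁ g ∘ F₁ f
      F-resp-≈     : ∀ {A B} {f g : Hom A B} → f ≈ g → F₁ f ≈ F₁ g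

  Id : Endofunctor
  Id = record
    { F₀ = λ X → X ; F₁ = λ f → f
    ; identity = IsEquivalence.refl equiv
    ; homomorphism = IsEquivalence.refl equiv
    ; F-resp-≈ = λ p → p }

  _∘F_ : Endofunctor → Endofunctor → Endofunctor
  G ∘F F = record
    { F₀ = λ X → G.F₀ (F.F₀ X)
    ; F₁ = λ f → G.F₁ (F.F₁ f)
    ; identity = IsEquivalence.trans equiv (G.F-resp-≈ F.identity) G.identity
    ; homomorphism = IsEquivalence.trans equiv (G.F-resp-≈ F.homomorphism) G.homomorphism
    ; F-resp-≈ = λ p → G.F-resp-≈ (F.F-resp-≈ p) }
    where
      module G = Endofunctor G
      module F = Endofunctor F

  record NatTrans (F G : Endofunctor) : Set (o ⊔ ℓ ⊔ e) where
    private
      module F = Endofunctor F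
      module G = Endofunctor G
    field
      η           : ∀ X → Hom (F.F₀ X) (G.F₀ X)
      commute     : ∀ {X Y} (f : Hom X Y) → η Y ∘ F.F₁ f ≈ G.F₁ f ∘ η X

  record DLObj (B : Endofunctor) : Set (o ⊔ ℓ ⊔ e) where
    constructor _,_
    field
      functor : Endofunctor
      law     : NatTrans (functor ∘F B) (B ∘F functor)

  record DLHom (B : Endofunctor) (X Y : DLObj B) : Set (o ⊔ ℓ ⊔ e) where
    private
      module B = Endofunctor B
      module X = DLObj X
      module Y = DLObj Y
    field
      nat     : NatTrans X.functor Y.functor
      compat  : ∀ A → NatTrans.η Y.law A ∘ NatTrans.η nat (B.F₀ A)
                      ≈ B.F₁ (NatTrans.η nat A) ∘ NatTrans.η X.law A

  _≈DL_ : ∀ {B X Y} → DLHom B X Y → DLHom B X Y → Set (o ⊔ e)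
  κ ≈DL κ′ = ∀ A → NatTrans.η (DLHom.nat κ) A ≈ NatTrans.η (DLHom.nat κ′) A

  record IsFinalDL (B : Endofunctor) (Z : DLObj B) : Set (suc (o ⊔ ℓ ⊔ e)) where
    field
      !        : ∀ (X : DLObj B) → DLHom B X Z
      !-unique : ∀ {X : DLObj B} (κ : DLHom B X Z) → ! X ≈DL κ

  IsCompanion : (B : Endofunctor) → DLObj B → Set (suc (o ⊔ ℓ ⊔ e))
  IsCompanion B Z = IsFinalDL B Z

module Submission where

-- Write ζ = τ₀ ∘ T!  for the coalgebra structure on Z = T0.
-- Both α and μ₀ ∘ λ̄_Z are coalgebra morphisms from the lifted coalgebra
-- (F Z , λ_Z ∘ F ζ) to (Z , ζ), and such morphisms are unique.
--
--  * Uniqueness (the half of finality of (T0 , ζ) that is needed): a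
--    coalgebra (X , c) is the same as a constant functor with the constant
--    distributive law c; a coalgebra morphism f : (X , c) → (T0 , ζ) yields
--    the DL(B)-morphism with components T! ∘ f, whose 0-component is f.
--    Finality of the companion then forces any two such f to agree.
--  * Every DL(B)-morphism κ : (F , λ) → (G , ρ) is a coalgebra morphism
--    between the lifted coalgebras (F X , λ_X ∘ F c) and (G X , ρ_X ∘ G c);
--    for κ = λ̄ and c = ζ this handles λ̄_Z.
--  * μ₀ is a coalgebra morphism (T Z , τ_Z ∘ T ζ) → (Z , ζ), by naturality
--    of μ and its compatibility with τ.
-- The theorem follows since coalgebra morphisms compose.

open import Defs
open import Level using (Level)
open import Relation.Binary using (Setoid; IsEquivalence)
import Relation.Binary.Reasoning.Setoid as SetoidReasoning

module CategoryReasoning {o ℓ e : Level} (C : Category o ℓ e) where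
  open Category C

  module ≈ {A B : Obj} = IsEquivalence (equiv {A} {B})

  hom-setoid : Obj → Obj → Setoid ℓ e
  hom-setoid A B = record { Carrier = Hom A B ; _≈_ = _≈_ ; isEquivalence = equiv }

  module HomReasoning {A B : Obj} = SetoidReasoning (hom-setoid A B)

  infixr 4 _⟩∘⟨_ refl⟩∘⟨_
  infixl 5 _⟩∘⟨refl

  _⟩∘⟨_ : ∀ {A B D} {f h : Hom B D} {g i : Hom A B} → f ≈ h → g ≈ i → f ∘ g ≈ h ∘ i
  _⟩∘⟨_ = ∘-resp-≈

  refl⟩∘⟨_ : ∀ {A B D} {f : Hom B D} {g i : Hom A B} → g ≈ i → f ∘ g ≈ f ∘ i
  refl⟩∘⟨ p = ∘-resp-≈ ≈.refl p

  _⟩∘⟨refl : ∀ {A B D} {f h : Hom B D} {g : Hom A B} → f ≈ h → f ∘ g ≈ h ∘ g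
  p ⟩∘⟨refl = ∘-resp-≈ p ≈.refl

  sym-assoc : ∀ {A B D E} {f : Hom A B} {g : Hom B D} {h : Hom D E} →
              h ∘ (g ∘ f) ≈ (h ∘ g) ∘ f
  sym-assoc = ≈.sym assoc

module Coalgebras {o ℓ e : Level} (C : Category o ℓ e) (B : Endofunctor C) where
  open Category C
  open CategoryReasoning C
  open HomReasoning
  private
    module B = Endofunctor B

  IsCoalgHom : ∀ {X Y} → Hom X (B.F₀ X) → Hom Y (B.F₀ Y) → Hom X Y → Set e
  IsCoalgHom c d f = d ∘ f ≈ B.F₁ f ∘ c

  coalgHom-∘ : ∀ {X Y W} {c : Hom X (B.F₀ X)} {d : Hom Y (B.F₀ Y)} {k : Hom W (B.F₀ W)}
               {f : Hom X Y} {g : Hom Y W} →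
               IsCoalgHom d k g → IsCoalgHom c d f → IsCoalgHom c k (g ∘ f)
  coalgHom-∘ {c = c} {d} {k} {f} {g} hg hf = begin
    k ∘ (g ∘ f)              ≈⟨ sym-assoc ⟩
    (k ∘ g) ∘ f              ≈⟨ hg ⟩∘⟨refl ⟩
    (B.F₁ g ∘ d) ∘ f         ≈⟨ assoc ⟩
    B.F₁ g ∘ (d ∘ f)         ≈⟨ refl⟩∘⟨ hf ⟩
    B.F₁ g ∘ (B.F₁ f ∘ c)    ≈⟨ sym-assoc ⟩
    (B.F₁ g ∘ B.F₁ f) ∘ c    ≈⟨ ≈.sym B.homomorphism ⟩∘⟨refl ⟩
    B.F₁ (g ∘ f) ∘ c         ∎

  lift : {F : Endofunctor C} → NatTrans C (_∘F_ C F B) (_∘F_ C B F) →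
         ∀ {X} → Hom X (B.F₀ X) → Hom (Endofunctor.F₀ F X) (B.F₀ (Endofunctor.F₀ F X))
  lift {F} λ′ {X} c = NatTrans.η λ′ X ∘ Endofunctor.F₁ F c

  DLHom-coalgHom : ∀ {F G λ′ ρ} (κ : DLHom C B (F , λ′) (G , ρ)) {X} (c : Hom X (B.F₀ X)) →
                   IsCoalgHom (lift λ′ c) (lift ρ c) (NatTrans.η (DLHom.nat κ) X)
  DLHom-coalgHom {F} {G} {λ′} {ρ} κ {X} c = begin
    (ρ_ X ∘ G.F₁ c) ∘ κ_ X          ≈⟨ assoc ⟩
    ρ_ X ∘ (G.F₁ c ∘ κ_ X)          ≈⟨ refl⟩∘⟨ ≈.sym (NatTrans.commute (DLHom.nat κ) c) ⟩
    ρ_ X ∘ (κ_ (B.F₀ X) ∘ F.F₁ c)   ≈⟨ sym-assoc ⟩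
    (ρ_ X ∘ κ_ (B.F₀ X)) ∘ F.F₁ c   ≈⟨ DLHom.compat κ X ⟩∘⟨refl ⟩
    (B.F₁ (κ_ X) ∘ λ′_ X) ∘ F.F₁ c   ≈⟨ assoc ⟩
    B.F₁ (κ_ X) ∘ (λ′_ X ∘ F.F₁ c)   ∎
    where
    module F = Endofunctor F
    module G = Endofunctor G
    κ_ = NatTrans.η (DLHom.nat κ)
    ρ_ = NatTrans.η ρ
    λ′_ = NatTrans.η λ′

  Const : Obj → Endofunctor C
  Const X = record
    { F₀ = λ _ → X ; F₁ = λ _ → id
    ; identity = ≈.refl ; homomorphism = ≈.sym identityˡ ; F-resp-≈ = λ _ → ≈.refl }

  coalgebra-DLObj : (X : Obj) → Hom X (B.F₀ X) → DLObj C B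
  coalgebra-DLObj X c = Const X , record
    { η = λ _ → c
    ; commute = λ _ → begin
        c ∘ id          ≈⟨ identityʳ ⟩
        c               ≈⟨ ≈.sym identityˡ ⟩
        id ∘ c          ≈⟨ ≈.sym B.identity ⟩∘⟨refl ⟩
        B.F₁ id ∘ c     ∎ }

module Companion {o ℓ e : Level} (C : Category o ℓ e)
                 (𝟘 : Category.Obj C) (init : IsInitial C 𝟘) (B T : Endofunctor C)
                 (τ : NatTrans C (_∘F_ C T B) (_∘F_ C B T))
                 (companion : IsCompanion C B (T , τ)) where
  open Category C
  open CategoryReasoning C
  open HomReasoning
  open Coalgebras C B
  open IsInitial init
  private
    module B = Endofunctor B
    module T = Endofunctor T
    τ_ = NatTrans.η τ

  Z : Obj
  Z = T.F₀ 𝟘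

  ζ : Hom Z (B.F₀ Z)
  ζ = τ_ 𝟘 ∘ T.F₁ (! {B.F₀ 𝟘})

  T!≈id : T.F₁ (! {𝟘}) ≈ id
  T!≈id = ≈.trans (T.F-resp-≈ (!-unique id)) T.identity

  T!-natural : ∀ {A A′} (g : Hom A A′) → T.F₁ (! {A′}) ≈ T.F₁ g ∘ T.F₁ (! {A})
  T!-natural g = ≈.trans (T.F-resp-≈ (!-unique (g ∘ !))) T.homomorphism

  τ-T!-factors : ∀ A → τ_ A ∘ T.F₁ (! {B.F₀ A}) ≈ B.F₁ (T.F₁ (! {A})) ∘ ζ
  τ-T!-factors A = begin
    τ_ A ∘ T.F₁ !                              ≈⟨ refl⟩∘⟨ T!-natural (B.F₁ !) ⟩
    τ_ A ∘ (T.F₁ (B.F₁ !) ∘ T.F₁ !)            ≈⟨ sym-assoc ⟩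
    (τ_ A ∘ T.F₁ (B.F₁ !)) ∘ T.F₁ !            ≈⟨ NatTrans.commute τ ! ⟩∘⟨refl ⟩
    (B.F₁ (T.F₁ !) ∘ τ_ 𝟘) ∘ T.F₁ !            ≈⟨ assoc ⟩
    B.F₁ (T.F₁ !) ∘ ζ                          ∎

  coalgHom⇒DLHom : ∀ {X} {c : Hom X (B.F₀ X)} {f : Hom X Z} →
                   IsCoalgHom c ζ f → DLHom C B (coalgebra-DLObj X c) (T , τ)
  coalgHom⇒DLHom {X} {c} {f} hf = record
    { nat = record
        { η = λ A → T.F₁ (! {A}) ∘ f
        ; commute = λ g → begin
            (T.F₁ ! ∘ f) ∘ id              ≈⟨ identityʳ ⟩
            T.F₁ ! ∘ f                     ≈⟨ T!-natural g ⟩∘⟨refl ⟩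
            (T.F₁ g ∘ T.F₁ !) ∘ f          ≈⟨ assoc ⟩
            T.F₁ g ∘ (T.F₁ ! ∘ f)          ∎ }
    ; compat = λ A → begin
        τ_ A ∘ (T.F₁ ! ∘ f)                ≈⟨ sym-assoc ⟩
        (τ_ A ∘ T.F₁ !) ∘ f                ≈⟨ τ-T!-factors A ⟩∘⟨refl ⟩
        (B.F₁ (T.F₁ !) ∘ ζ) ∘ f            ≈⟨ assoc ⟩
        B.F₁ (T.F₁ !) ∘ (ζ ∘ f)            ≈⟨ refl⟩∘⟨ hf ⟩
        B.F₁ (T.F₁ !) ∘ (B.F₁ f ∘ c)       ≈⟨ sym-assoc ⟩
        (B.F₁ (T.F₁ !) ∘ B.F₁ f) ∘ c       ≈⟨ ≈.sym B.homomorphism ⟩∘⟨refl ⟩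
        B.F₁ (T.F₁ ! ∘ f) ∘ c              ∎ }

  coalgHom-unique : ∀ {X} {c : Hom X (B.F₀ X)} {f g : Hom X Z} →
                    IsCoalgHom c ζ f → IsCoalgHom c ζ g → f ≈ g
  coalgHom-unique {X} {c} {f} {g} hf hg = begin
    f                 ≈⟨ ≈.sym identityˡ ⟩
    id ∘ f            ≈⟨ ≈.sym T!≈id ⟩∘⟨refl ⟩
    T.F₁ ! ∘ f        ≈⟨ ≈.sym (final.!-unique (coalgHom⇒DLHom hf) 𝟘) ⟩
    terminal-map 𝟘    ≈⟨ final.!-unique (coalgHom⇒DLHom hg) 𝟘 ⟩
    T.F₁ ! ∘ g        ≈⟨ T!≈id ⟩∘⟨refl ⟩
    id ∘ g            ≈⟨ identityˡ ⟩
    g                 ∎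
    where
    module final = IsFinalDL companion
    terminal-map : ∀ A → Hom X (T.F₀ A)
    terminal-map = NatTrans.η (DLHom.nat (final.! (coalgebra-DLObj X c)))

  μ-coalgHom : (μ : NatTrans C (_∘F_ C T T) T) →
               (∀ X → τ_ X ∘ NatTrans.η μ (B.F₀ X)
                      ≈ B.F₁ (NatTrans.η μ X) ∘ (τ_ (T.F₀ X) ∘ T.F₁ (τ_ X))) →
               IsCoalgHom (lift τ ζ) ζ (NatTrans.η μ 𝟘)
  μ-coalgHom μ μ-τ = begin
    (τ_ 𝟘 ∘ T.F₁ !) ∘ μ_ 𝟘                            ≈⟨ assoc ⟩
    τ_ 𝟘 ∘ (T.F₁ ! ∘ μ_ 𝟘)                            ≈⟨ refl⟩∘⟨ ≈.sym (NatTrans.commute μ !) ⟩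
    τ_ 𝟘 ∘ (μ_ (B.F₀ 𝟘) ∘ T.F₁ (T.F₁ !))              ≈⟨ sym-assoc ⟩
    (τ_ 𝟘 ∘ μ_ (B.F₀ 𝟘)) ∘ T.F₁ (T.F₁ !)              ≈⟨ μ-τ 𝟘 ⟩∘⟨refl ⟩
    (B.F₁ (μ_ 𝟘) ∘ (τ_ Z ∘ T.F₁ (τ_ 𝟘))) ∘ T.F₁ (T.F₁ !)
                                                      ≈⟨ assoc ⟩
    B.F₁ (μ_ 𝟘) ∘ ((τ_ Z ∘ T.F₁ (τ_ 𝟘)) ∘ T.F₁ (T.F₁ !))
                                                      ≈⟨ refl⟩∘⟨ assoc ⟩
    B.F₁ (μ_ 𝟘) ∘ (τ_ Z ∘ (T.F₁ (τ_ 𝟘) ∘ T.F₁ (T.F₁ !)))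
                                                      ≈⟨ refl⟩∘⟨ refl⟩∘⟨ ≈.sym T.homomorphism ⟩
    B.F₁ (μ_ 𝟘) ∘ (τ_ Z ∘ T.F₁ ζ)                     ∎
    where μ_ = NatTrans.η μ

proposition4p5 :
  ∀ {o ℓ e : Level} (C : Category o ℓ e) →
  let open Category C in
  (𝟘 : Obj) (init : IsInitial C 𝟘) →
  (B : Endofunctor C) →
  (T : Endofunctor C) (τ : NatTrans C (_∘F_ C T B) (_∘F_ C B T)) →
  IsCompanion C B (T , τ) →
  let module B = Endofunctor B
      module T = Endofunctor T
      τ_ = NatTrans.η τ
  in
  -- the corresponding monad (T , η , μ), characterised by
  -- B η = τ ∘ η B   and   τ ∘ μ B = B μ ∘ τ T ∘ T τ
  (ηT : NatTrans C (Id C) T) →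
  (∀ X → B.F₁ (NatTrans.η ηT X) ≈ τ_ X ∘ NatTrans.η ηT (B.F₀ X)) →
  (μ : NatTrans C (_∘F_ C T T) T) →
  (∀ X → τ_ X ∘ NatTrans.η μ (B.F₀ X)
         ≈ B.F₁ (NatTrans.η μ X) ∘ (τ_ (T.F₀ X) ∘ T.F₁ (τ_ X))) →
  -- a functor F with a natural λ : F B ⇒ B F
  (F : Endofunctor C) (λ′ : NatTrans C (_∘F_ C F B) (_∘F_ C B F)) →
  let module F = Endofunctor F
      Z = T.F₀ 𝟘
      ζ = τ_ 𝟘 ∘ T.F₁ (IsInitial.! init {B.F₀ 𝟘})
  in
  -- α : F T0 → T0 the algebra induced by λ on the final coalgebra (T0 , ζ)
  (α : Hom (F.F₀ Z) Z) →
  ζ ∘ α ≈ B.F₁ α ∘ (NatTrans.η λ′ Z ∘ F.F₁ ζ) →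
  -- λ̄ : (F , λ) → (T , τ) the (unique) morphism in DL(B)
  (λ̄ : DLHom C B (F , λ′) (T , τ)) →
  α ≈ NatTrans.η μ 𝟘 ∘ NatTrans.η (DLHom.nat λ̄) Z
proposition4p5 C 𝟘 init B T τ companion _ _ μ μ-τ F λ′ α α-coalgHom λ̄ =
  -- Both sides are coalgebra morphisms (F Z , λ_Z ∘ F ζ) → (Z , ζ).
  coalgHom-unique α-coalgHom
    (coalgHom-∘ (μ-coalgHom μ μ-τ) (DLHom-coalgHom λ̄ ζ))
  where
  open Coalgebras C B
  open Companion C 𝟘 init B T τ companion
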